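{- Fix integers $\theta\ge 0$ and $\tau=0$. Under the duality bijection between homopolymer secondary structures with at least one link and admissible weighted rooted plane trees (described in the context), a secondary structure $S$ with at least one link is saturated if and only if its dual weighted tree $T$ satisfies both: (i) every corner of $T$ has weight at most $\theta+1$; (ii) at each node of $T$ there is at most one incident corner of strictly positive weight.
   Context: A homopolymer secondary structure of length $n$ with parameters $\theta,\tau\ge0$ is a set $S$ of pairs (links) $(i,j)$, $1\le i<j\le n$, such that no position lies in two links, there are no $(i,j),(k,\ell)\in S$ with $i<k<j<\ell$, every $(i,j)\in S$ has $j-i>\theta$, and every stem has length at least $\tau$. A link $(i,j)$ is stacked onto $(i',j')$ if $i'=i+1$, $j'=j-1$; a stem is a maximal sequence of links $\ell_0,\dots,\ell_k$ with $\ell_m$ stacked onto $\ell_{m+1}$, and $k$ is its length. A position is free if it is in no link. $S$ is saturated if there is no pair $(i,j)\notin S$ such that $S\cup\{(i,j)\}$ is again a secondary structure (same $\theta,\tau$). Duality: a segment of $S$ is a sequence $i,i+1,\dots,j$ with $i<j$, where $i=0$ or $i$ is linked, $j=n+1$ or $j$ is linked, and all of $i+1,\dots,j-1$ are free; it contains $j-i-1$ free elements. Replace each stem by a single link and each segment by a segment with no free element, obtaining a reduced structure $R$. Draw $R$ as arcs above a line; put a vertex in each region (including the outer region) and, for each link, an edge joining the regions on its two sides. The result is a plane tree $T$, rooted at the outer-region vertex, with the root placed between the segment starting at $0$ and the segment ending at $n+1$. Edges of $T$ correspond to stems of $S$ and corners of $T$ (angular sectors between consecutive edges around a vertex, the root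 splitting a sector at the root vertex) correspond to segments of $S$. Each corner is given as weight the number of free elements of its segment, each edge the length of its stem. A leaf is a node with no children; an inner node has at least one child. Such a weighted tree is admissible if: each non-root node with exactly one child has at least one of its two corners of positive weight; each corner at a leaf has weight at least $\theta$; each edge has weight at least $\tau$. This gives a bijection between secondary structures with at least one link and admissible weighted rooted plane trees with at least one edge. -}

module Defs where

open import Data.Nat using (ℕ; zero; suc; _+_; _∸_; _≤_; _<_; _≟_; _<?_)
open import Data.Nat.Properties using () renaming (_≟_ to _≟ℕ_)
open import Data.Product using (_×_; _,_; proj₁; proj₂)
open import Data.Product.Properties using (≡-dec)
open import Data.Sum using (_⊎_)
open import Data.Unit using (⊤)
open import Data.Maybe using (Maybe; just; nothing)
open import Data.List using (List; []; _∷_; map; filter; length)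
open import Data.List.Relation.Unary.All using (All)
open import Data.List.Membership.Propositional using (_∈_; _∉_)
open import Data.List.Membership.DecPropositional (≡-dec _≟ℕ_ _≟ℕ_) using () renaming (_∈?_ to _∈?ₚ_)
open import Relation.Nullary using (¬_; yes; no)
open import Relation.Binary.PropositionalEquality using (_≡_)

-- Homopolymer secondary structures.
-- A structure of length n is given by a list of links (i , j); the
-- structure is the SET of members of the list.

Link : Set
Link = ℕ × ℕ

record SecStr (θ τ n : ℕ) (S : List Link) : Set where
  field
    bounds      : ∀ {i j} → (i , j) ∈ S → 1 ≤ i × i < j × j ≤ n
    minLoop     : ∀ {i j} → (i , j) ∈ S → θ < j ∸ i
    disjoint    : ∀ {i j k l} → (i , j) ∈ S → (k , l) ∈ S →
                  (i ≡ k ⊎ i ≡ l ⊎ j ≡ k ⊎ j ≡ l) → (i , j) ≡ (k , l)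
    noncrossing : ∀ {i j k l} → (i , j) ∈ S → (k , l) ∈ S →
                  ¬ (i < k × k < j × j < l)
    -- every stem has length ≥ τ: if (i , j) starts a stem (i.e. no link
    -- (i-1 , j+1) is stacked under it from outside), then the links
    -- (i+m , j-m) for m = 0..τ all belong to S (so ℓ_τ exists).
    stems       : ∀ {i j} → (i , j) ∈ S → (i ∸ 1 , suc j) ∉ S →
                  ∀ m → m ≤ τ → (i + m , j ∸ m) ∈ S

Saturated : (θ τ n : ℕ) → List Link → Set
Saturated θ τ n S = ∀ i j → (i , j) ∉ S → ¬ SecStr θ τ n ((i , j) ∷ S)

-- A node with k children carries k+1 corners, listed in plane order:
--   node c₀ ((e₁ , t₁ , c₁) ∷ … ∷ (e_k , t_k , c_k) ∷ [])
-- c₀ , … , c_k are the corner weights, e_m is the weight of the edge to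
-- the m-th child t_m.  (At the root, c₀ is the corner after the root
-- split and c_k the one before it.)

data Tree : Set where
  node : ℕ → List (ℕ × Tree × ℕ) → Tree

corners : Tree → List ℕ
corners (node c l) = c ∷ map (λ x → proj₂ (proj₂ x)) l

mutual
  EveryNode : (Tree → Set) → Tree → Set
  EveryNode P (node c l) = P (node c l) × EveryChild P l

  EveryChild : (Tree → Set) → List (ℕ × Tree × ℕ) → Set
  EveryChild P [] = ⊤
  EveryChild P ((e , t , c) ∷ l) = EveryNode P t × EveryChild P l

CondI : ℕ → Tree → Set
CondI θ = EveryNode (λ t → All (λ w → w ≤ suc θ) (corners t))

CondII : Tree → Set
CondII = EveryNode (λ t → length (filter (0 <?_) (corners t)) ≤ 1)

opener : List Link → ℕ → Maybe ℕ
opener [] p = nothing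
opener ((i , j) ∷ S) p with i ≟ p
... | yes _ = just j
... | no  _ = opener S p

-- follow the stem starting with link (i , j) inwards:
-- returns (stem length k , innermost link (i+k , j-k))
stem : List Link → ℕ → ℕ → ℕ → ℕ × ℕ × ℕ
stem S zero i j = 0 , i , j
stem S (suc f) i j with (suc i , j ∸ 1) ∈?ₚ S
... | yes _ = let r = stem S f (suc i) (j ∸ 1) in suc (proj₁ r) , proj₂ r
... | no  _ = 0 , i , j

-- scan S n fuel p b acc : reads the region whose remaining part is the
-- positions p, p+1, …, b-1 (b is the closing position of the region),
-- where acc free elements of the current segment have already been seen.
-- Returns the weight of the current corner followed by the list of
-- (edge weight , subtree , following corner weight).
scan : List Link → ℕ → ℕ → ℕ → ℕ → ℕ → ℕ × List (ℕ × Tree × ℕ)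
scan S n zero p b acc = acc , []
scan S n (suc f) p b acc with p <? b
... | no  _ = acc , []
... | yes _ with opener S p
...   | nothing = scan S n f (suc p) b (suc acc)
...   | just q  =
  let st   = stem S n p q
      k    = proj₁ st
      i'   = proj₁ (proj₂ st)
      j'   = proj₂ (proj₂ st)
      sub  = scan S n f (suc i') j' 0
      rest = scan S n f (suc q) b 0
  in acc , (k , node (proj₁ sub) (proj₂ sub) , proj₁ rest) ∷ proj₂ rest

-- The dual weighted rooted plane tree of a structure S of length n:
-- the root region is delimited by the virtual positions 0 and n+1.
dual : ℕ → List Link → Tree
dual n S = let r = scan S n (suc (suc n)) 1 (suc n) 0 in node (proj₁ r) (proj₂ r)

module Submission where

-- Since τ = 0, a link (i , j) can be added to S exactly when i and j are free, no link of S crosses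
-- (i , j) and j - i > θ; that is, when i and j are free elements of one region of the arc diagram,
-- hence of corners at one node of the dual tree, at distance more than θ. Reading a region from left
-- to right, the free elements of a corner form a block of consecutive positions, and free elements of
-- different corners are separated by a link, whose span exceeds θ. So such a pair exists iff some
-- corner has weight at least θ + 2 or some node has two corners of positive weight.

open import Defs
open import Level using (0ℓ)
open import Data.Nat using (ℕ; zero; suc; _+_; _∸_; _≤_; _<_; _≟_; _≤?_; _<?_; z≤n; s≤s)
open import Data.Nat.Properties
open import Data.Product using (_×_; _,_; proj₁; proj₂; ∃-syntax)
open import Data.Product.Properties using (≡-dec)
open import Data.Sum using (_⊎_; inj₁; inj₂; map₁)
open import Data.Unit using (tt)
open import Data.Empty using (⊥; ⊥-elim)
open import Data.Maybe using (just; nothing)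
open import Data.List using (List; []; _∷_; map; filter; length)
open import Data.List.Relation.Unary.All as All using (All; []; _∷_)
open import Data.List.Relation.Unary.Any using (here; there)
open import Data.List.Membership.Propositional using (_∈_; _∉_)
open import Data.List.Membership.DecPropositional (≡-dec _≟_ _≟_) using () renaming (_∈?_ to _∈?ₚ_)
open import Function.Base using (_∘_)
open import Function.Bundles using (_⇔_; mk⇔)
open import Function.Properties.Equivalence using (⇔-setoid)
open import Relation.Nullary using (¬_; yes; no)
open import Relation.Binary.Definitions using (tri<; tri≈; tri>)
open import Relation.Binary.PropositionalEquality using (_≡_; refl; sym; trans; cong; subst; subst₂)
import Relation.Binary.Reasoning.Setoid as SetoidReasoning

opener≡nothing⇒∉ : ∀ S p → opener S p ≡ nothing → ∀ q → (p , q) ∉ S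
opener≡nothing⇒∉ ((i , j) ∷ S) p e q m with i ≟ p
opener≡nothing⇒∉ ((i , j) ∷ S) p () q m           | yes _
opener≡nothing⇒∉ ((i , j) ∷ S) p e q (here refl)  | no i≢p = i≢p refl
opener≡nothing⇒∉ ((i , j) ∷ S) p e q (there m)    | no _   = opener≡nothing⇒∉ S p e q m

opener≡just⇒∈ : ∀ S p q → opener S p ≡ just q → (p , q) ∈ S
opener≡just⇒∈ ((i , j) ∷ S) p q e with i ≟ p
opener≡just⇒∈ ((i , j) ∷ S) p q refl | yes refl = here refl
opener≡just⇒∈ ((i , j) ∷ S) p q e    | no _     = there (opener≡just⇒∈ S p q e)

p+0∈S : ∀ (S : List Link) {p q} → (p , q) ∈ S → (p + 0 , q) ∈ S
p+0∈S S {p} {q} = subst (λ x → (x , q) ∈ S) (sym (+-identityʳ p))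

stem-spec : ∀ S f p q → (p , q) ∈ S →
  let (k , i′ , j′) = stem S f p q in
  i′ ≡ p + k × j′ ≡ q ∸ k × (∀ m → m ≤ k → (p + m , q ∸ m) ∈ S)
stem-spec S zero p q pq = sym (+-identityʳ p) , refl , λ { .0 z≤n → p+0∈S S pq }
stem-spec S (suc f) p q pq with (suc p , q ∸ 1) ∈?ₚ S
... | no _ = sym (+-identityʳ p) , refl , λ { .0 z≤n → p+0∈S S pq }
... | yes pq′ =
  let (i′≡ , j′≡ , links) = stem-spec S f (suc p) (q ∸ 1) pq′
      k = proj₁ (stem S f (suc p) (q ∸ 1))
  in trans i′≡ (sym (+-suc p k)) , trans j′≡ (∸-+-assoc q 1 k) ,
     λ { .0 z≤n → p+0∈S S pq
       ; (suc m) (s≤s m≤k) →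
           subst₂ (λ u v → (u , v) ∈ S) (sym (+-suc p m)) (∸-+-assoc q 1 m) (links m m≤k) }

ScanResult : Set
ScanResult = ℕ × List (ℕ × Tree × ℕ)

toNode : ScanResult → Tree
toNode r = node (proj₁ r) (proj₂ r)

laterCorners : ScanResult → List ℕ
laterCorners r = map (λ x → proj₂ (proj₂ x)) (proj₂ r)

scan-acc≤ : ∀ S n f p b acc → acc ≤ proj₁ (scan S n f p b acc)
scan-acc≤ S n zero p b acc = ≤-refl
scan-acc≤ S n (suc f) p b acc with p <? b
... | no _ = ≤-refl
... | yes _ with opener S p
...   | nothing = ≤-trans (n≤1+n acc) (scan-acc≤ S n f (suc p) b (suc acc))
...   | just _  = ≤-refl

fuel-step : ∀ {b p q f} → p ≤ q → b ≤ p + suc f → b ≤ suc q + f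
fuel-step {p = p} {f = f} p≤q b≤ = ≤-trans b≤ (≤-trans (≤-reflexive (+-suc p f)) (+-monoˡ-≤ f (s≤s p≤q)))

positives : List ℕ → ℕ
positives L = length (filter (0 <?_) L)

positives-tail : ∀ c L → positives L ≤ positives (c ∷ L)
positives-tail zero    L = ≤-refl
positives-tail (suc c) L = n≤1+n _

positive-head : ∀ {c} L → 0 < c → 1 ≤ positives (c ∷ L)
positive-head {suc c} L _ = s≤s z≤n

positive-somewhere : ∀ {c L d} → d < c ⊎ 1 ≤ positives L → 1 ≤ positives (c ∷ L)
positive-somewhere {L = L} (inj₁ d<c) = positive-head L (≤-<-trans z≤n d<c)
positive-somewhere {c} {L} (inj₂ 1≤L) = ≤-trans 1≤L (positives-tail c L)

mutual
  EveryNode-map : ∀ {A B : Tree → Set} → (∀ {t} → A t → B t) → ∀ t → EveryNode A t → EveryNode B t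
  EveryNode-map f (node c l) (a , as) = f a , EveryChild-map f l as

  EveryChild-map : ∀ {A B : Tree → Set} → (∀ {t} → A t → B t) → ∀ l → EveryChild A l → EveryChild B l
  EveryChild-map f []              _        = tt
  EveryChild-map f ((_ , t , _) ∷ l) (a , as) = EveryNode-map f t a , EveryChild-map f l as

mutual
  EveryNode-zip : ∀ {A B : Tree → Set} t → EveryNode A t → EveryNode B t → EveryNode (λ u → A u × B u) t
  EveryNode-zip (node c l) (a , as) (b , bs) = (a , b) , EveryChild-zip l as bs

  EveryChild-zip : ∀ {A B : Tree → Set} l → EveryChild A l → EveryChild B l → EveryChild (λ u → A u × B u) l
  EveryChild-zip []                _        _        = tt
  EveryChild-zip ((_ , t , _) ∷ l) (a , as) (b , bs) = EveryNode-zip t a b , EveryChild-zip l as bs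

EveryNode-× : ∀ {A B : Tree → Set} t → EveryNode (λ u → A u × B u) t ⇔ (EveryNode A t × EveryNode B t)
EveryNode-× t = mk⇔ (λ ab → EveryNode-map proj₁ t ab , EveryNode-map proj₂ t ab)
                    (λ (a , b) → EveryNode-zip t a b)

GoodNode : ℕ → Tree → Set
GoodNode θ t = All (λ w → w ≤ suc θ) (corners t) × positives (corners t) ≤ 1

Free : List Link → ℕ → Set
Free S x = (∀ l → (x , l) ∉ S) × (∀ k → (k , x) ∉ S)

record Insertable (θ n : ℕ) (S : List Link) (i j : ℕ) : Set where
  field
    lower   : 1 ≤ i
    ordered : i < j
    upper   : j ≤ n
    loop    : θ < j ∸ i
    freeˡ   : Free S i
    freeʳ   : Free S j
    noCrossingInside  : ∀ {k l} → (k , l) ∈ S → i < k → k < j → j < l → ⊥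
    noCrossingOutside : ∀ {k l} → (k , l) ∈ S → k < i → i < l → l < j → ⊥

insertable : ∀ {θ τ n S i j} → SecStr θ τ n ((i , j) ∷ S) → (i , j) ∉ S → Insertable θ n S i j
insertable {S = S} {i} {j} ss ij∉S = record
  { lower   = proj₁ (bounds (here refl))
  ; ordered = proj₁ (proj₂ (bounds (here refl)))
  ; upper   = proj₂ (proj₂ (bounds (here refl)))
  ; loop    = minLoop (here refl)
  ; freeˡ   = (λ _ → unlinked (inj₁ refl)) , (λ _ → unlinked (inj₂ (inj₁ refl)))
  ; freeʳ   = (λ _ → unlinked (inj₂ (inj₂ (inj₁ refl)))) , (λ _ → unlinked (inj₂ (inj₂ (inj₂ refl))))
  ; noCrossingInside  = λ kl i<k k<j j<l → noncrossing (here refl) (there kl) (i<k , k<j , j<l)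
  ; noCrossingOutside = λ kl k<i i<l l<j → noncrossing (there kl) (here refl) (k<i , i<l , l<j)
  }
  where
  open SecStr ss
  unlinked : ∀ {k l} → (i ≡ k ⊎ i ≡ l ⊎ j ≡ k ⊎ j ≡ l) → (k , l) ∉ S
  unlinked shared kl = ij∉S (subst (_∈ S) (sym (disjoint (here refl) (there kl) shared)) kl)

insert : ∀ {θ n S i j} → SecStr θ 0 n S → Insertable θ n S i j → SecStr θ 0 n ((i , j) ∷ S)
insert {θ} {n} {S} {i} {j} ss ins = record
  { bounds      = λ { (here refl) → lower , ordered , upper ; (there m) → bounds m }
  ; minLoop     = λ { (here refl) → loop ; (there m) → minLoop m }
  ; disjoint    = disjoint′
  ; noncrossing = noncrossing′
  ; stems       = λ m _ → λ { .0 z≤n → p+0∈S _ m }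
  }
  where
  open SecStr ss
  open Insertable ins

  free-disjoint : ∀ {x k l} → Free S x → (k , l) ∈ S → ¬ (x ≡ k ⊎ x ≡ l)
  free-disjoint {l = l} fx m (inj₁ refl) = proj₁ fx l m
  free-disjoint {k = k} fx m (inj₂ refl) = proj₂ fx k m

  disjoint′ : ∀ {a b c d} → (a , b) ∈ (i , j) ∷ S → (c , d) ∈ (i , j) ∷ S →
              (a ≡ c ⊎ a ≡ d ⊎ b ≡ c ⊎ b ≡ d) → (a , b) ≡ (c , d)
  disjoint′ (here refl) (here refl) _                      = refl
  disjoint′ (here refl) (there m) (inj₁ e)                 = ⊥-elim (free-disjoint freeˡ m (inj₁ e))
  disjoint′ (here refl) (there m) (inj₂ (inj₁ e))          = ⊥-elim (free-disjoint freeˡ m (inj₂ e))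
  disjoint′ (here refl) (there m) (inj₂ (inj₂ (inj₁ e)))   = ⊥-elim (free-disjoint freeʳ m (inj₁ e))
  disjoint′ (here refl) (there m) (inj₂ (inj₂ (inj₂ e)))   = ⊥-elim (free-disjoint freeʳ m (inj₂ e))
  disjoint′ (there m) (here refl) (inj₁ e)                 = ⊥-elim (free-disjoint freeˡ m (inj₁ (sym e)))
  disjoint′ (there m) (here refl) (inj₂ (inj₁ e))          = ⊥-elim (free-disjoint freeʳ m (inj₁ (sym e)))
  disjoint′ (there m) (here refl) (inj₂ (inj₂ (inj₁ e)))   = ⊥-elim (free-disjoint freeˡ m (inj₂ (sym e)))
  disjoint′ (there m) (here refl) (inj₂ (inj₂ (inj₂ e)))   = ⊥-elim (free-disjoint freeʳ m (inj₂ (sym e)))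
  disjoint′ (there m) (there m′) shared                    = disjoint m m′ shared

  noncrossing′ : ∀ {a b c d} → (a , b) ∈ (i , j) ∷ S → (c , d) ∈ (i , j) ∷ S → ¬ (a < c × c < b × b < d)
  noncrossing′ (here refl) (here refl) (i<i , _)  = <-irrefl refl i<i
  noncrossing′ (here refl) (there m) (i<k , k<j , j<l) = noCrossingInside m i<k k<j j<l
  noncrossing′ (there m) (here refl) (k<i , i<l , l<j) = noCrossingOutside m k<i i<l l<j
  noncrossing′ (there m) (there m′) crossing           = noncrossing m m′ crossing

saturated⇔noInsertable : ∀ {θ n S} → SecStr θ 0 n S →
                         Saturated θ 0 n S ⇔ (∀ i j → ¬ Insertable θ n S i j)
saturated⇔noInsertable ss = mk⇔
  (λ sat i j ins → sat i j (proj₁ (Insertable.freeˡ ins) j) (insert ss ins))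
  (λ noIns i j ij∉S ss′ → noIns i j (insertable ss′ ij∉S))

module _ {θ τ n : ℕ} {S : List Link} (ss : SecStr θ τ n S) where
  open SecStr ss

  link< : ∀ {k l} → (k , l) ∈ S → k < l
  link< m = proj₁ (proj₂ (bounds m))

  record ClosedSpan (s p : ℕ) : Set where
    field
      start≤ : s ≤ p
      closes : ∀ {k l} → (k , l) ∈ S → s ≤ k → k < p → l < p

  closedSpan-refl : ∀ {s} → ClosedSpan s s
  closedSpan-refl = record { start≤ = ≤-refl ; closes = λ _ s≤k k<s → ⊥-elim (<⇒≱ k<s s≤k) }

  closedSpan-unopened : ∀ {s p} → ClosedSpan s p → (∀ l → (p , l) ∉ S) → ClosedSpan s (suc p)
  closedSpan-unopened {s} {p} C unopened =
    record { start≤ = ≤-trans start≤ (n≤1+n p) ; closes = closes′ }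
    where
    open ClosedSpan C
    closes′ : ∀ {k l} → (k , l) ∈ S → s ≤ k → k < suc p → l < suc p
    closes′ {k} {l} m s≤k k<1+p with <-cmp k p
    ... | tri< k<p _ _  = m<n⇒m<1+n (closes m s≤k k<p)
    ... | tri≈ _ refl _ = ⊥-elim (unopened l m)
    ... | tri> _ _ p<k  = ⊥-elim (<⇒≱ p<k (≤-pred k<1+p))

  closedSpan-link : ∀ {s p q} → ClosedSpan s p → (p , q) ∈ S → ClosedSpan s (suc q)
  closedSpan-link {s} {p} {q} C pq =
    record { start≤ = ≤-trans start≤ (<⇒≤ (m<n⇒m<1+n (link< pq))) ; closes = closes′ }
    where
    open ClosedSpan C
    closes′ : ∀ {k l} → (k , l) ∈ S → s ≤ k → k < suc q → l < suc q
    closes′ {k} {l} m s≤k k<1+q with <-cmp k p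
    ... | tri< k<p _ _  = <-trans (closes m s≤k k<p) (m<n⇒m<1+n (link< pq))
    ... | tri≈ _ refl _ = s≤s (≤-reflexive (cong proj₂ (disjoint m pq (inj₁ refl))))
    ... | tri> _ _ p<k with <-cmp k q
    ...   | tri≈ _ refl _ = ⊥-elim (<-irrefl (cong proj₁ (disjoint pq m (inj₂ (inj₂ (inj₁ refl))))) (link< pq))
    ...   | tri> _ _ q<k  = ⊥-elim (<⇒≱ q<k (≤-pred k<1+q))
    ...   | tri< k<q _ _ with <-cmp l q
    ...     | tri< l<q _ _  = m<n⇒m<1+n l<q
    ...     | tri≈ _ refl _ = ⊥-elim (<-irrefl (sym (cong proj₁ (disjoint m pq (inj₂ (inj₂ (inj₂ refl)))))) p<k)
    ...     | tri> _ _ q<l  = ⊥-elim (noncrossing pq m (p<k , k<q , q<l))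

  -- The positions s ≤ x < b enclosed by the link (s - 1 , b), or by the ends 0 and n + 1 for the outer region.
  record Region (s b : ℕ) : Set where
    field
      lower   : 1 ≤ s
      upper   : b ≤ suc n
      noEntry : ∀ {k l} → (k , l) ∈ S → k < s → s ≤ l → l < b → ⊥
      noExit  : ∀ {k l} → (k , l) ∈ S → s ≤ k → k < b → l < b

  rootRegion : Region 1 (suc n)
  rootRegion = record
    { lower   = ≤-refl
    ; upper   = ≤-refl
    ; noEntry = λ m k<1 _ _ → <⇒≱ k<1 (proj₁ (bounds m))
    ; noExit  = λ m _ _ → s≤s (proj₂ (proj₂ (bounds m)))
    }

  innerRegion : ∀ {u v} → (u , v) ∈ S → Region (suc u) v
  innerRegion {u} {v} uv = record
    { lower   = s≤s z≤n
    ; upper   = m≤n⇒m≤1+n (proj₂ (proj₂ (bounds uv)))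
    ; noEntry = noEntry
    ; noExit  = noExit
    }
    where
    noEntry : ∀ {k l} → (k , l) ∈ S → k < suc u → suc u ≤ l → l < v → ⊥
    noEntry {k} m k<1+u u<l l<v with <-cmp k u
    ... | tri< k<u _ _  = noncrossing m uv (k<u , u<l , l<v)
    ... | tri≈ _ refl _ = <-irrefl (cong proj₂ (disjoint m uv (inj₁ refl))) l<v
    ... | tri> _ _ u<k  = <⇒≱ u<k (≤-pred k<1+u)
    noExit : ∀ {k l} → (k , l) ∈ S → suc u ≤ k → k < v → l < v
    noExit {l = l} m u<k k<v with <-cmp l v
    ... | tri< l<v _ _  = l<v
    ... | tri≈ _ refl _ = ⊥-elim (<-irrefl (sym (cong proj₁ (disjoint m uv (inj₂ (inj₂ (inj₂ refl)))))) u<k)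
    ... | tri> _ _ v<l  = ⊥-elim (noncrossing uv m (u<k , k<v , v<l))

  -- The free elements of the corners of the node dual to the region (s , b).
  record Visible (s b x : ℕ) : Set where
    field
      start≤    : s ≤ x
      <end      : x < b
      free      : Free S x
      uncovered : ∀ {k l} → (k , l) ∈ S → s ≤ k → k < x → x < l → ⊥

  visible-unopened : ∀ {s b p} → Region s b → ClosedSpan s p → p < b → (∀ l → (p , l) ∉ S) → Visible s b p
  visible-unopened {s} {b} {p} R C p<b unopened = record
    { start≤    = start≤
    ; <end      = p<b
    ; free      = unopened , unclosed
    ; uncovered = λ m s≤k k<p p<l → <-asym p<l (closes m s≤k k<p)
    }
    where
    open ClosedSpan C
    unclosed : ∀ k → (k , p) ∉ S
    unclosed k m with s ≤? k
    ... | yes s≤k = <-irrefl refl (closes m s≤k (link< m))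
    ... | no  s≰k = Region.noEntry R m (≰⇒> s≰k) start≤ p<b

  record StemOf (p q i′ j′ : ℕ) : Set where
    field
      innermost   : (i′ , j′) ∈ S
      p≤i′        : p ≤ i′
      j′≤q        : j′ ≤ q
      pairedLeft  : ∀ {x} → p ≤ x → x ≤ i′ → ¬ Free S x
      pairedRight : ∀ {x} → j′ ≤ x → x ≤ q → ¬ Free S x

  stemOf : ∀ f {p q} → (p , q) ∈ S →
           let (_ , i′ , j′) = stem S f p q in StemOf p q i′ j′
  stemOf f {p} {q} pq = record
    { innermost   = subst₂ (λ u v → (u , v) ∈ S) (sym i′≡) (sym j′≡) (links k ≤-refl)
    ; p≤i′        = subst (p ≤_) (sym i′≡) (m≤m+n p k)
    ; j′≤q        = subst (_≤ q) (sym j′≡) (m∸n≤m q k)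
    ; pairedLeft  = pairedLeft
    ; pairedRight = pairedRight
    }
    where
    k = proj₁ (stem S f p q)
    spec = stem-spec S f p q pq
    i′≡ = proj₁ spec
    j′≡ = proj₁ (proj₂ spec)
    links = proj₂ (proj₂ spec)
    pairedLeft : ∀ {x} → p ≤ x → x ≤ proj₁ (proj₂ (stem S f p q)) → ¬ Free S x
    pairedLeft {x} p≤x x≤i′ fx = proj₁ fx (q ∸ (x ∸ p))
      (subst (λ u → (u , q ∸ (x ∸ p)) ∈ S) (m+[n∸m]≡n p≤x) (links (x ∸ p) x∸p≤k))
      where
      x∸p≤k : x ∸ p ≤ k
      x∸p≤k = subst (x ∸ p ≤_) (m+n∸m≡n p k) (∸-monoˡ-≤ p (subst (x ≤_) i′≡ x≤i′))
    pairedRight : ∀ {x} → proj₂ (proj₂ (stem S f p q)) ≤ x → x ≤ q → ¬ Free S x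
    pairedRight {x} j′≤x x≤q fx = proj₂ fx (p + (q ∸ x))
      (subst (λ v → (p + (q ∸ x) , v) ∈ S) (m∸[m∸n]≡n x≤q) (links (q ∸ x) q∸x≤k))
      where
      q≤k+x : q ≤ k + x
      q≤k+x = ≤-trans (m≤n+m∸n q k) (+-monoʳ-≤ k (subst (_≤ x) j′≡ j′≤x))
      q∸x≤k : q ∸ x ≤ k
      q∸x≤k = subst (q ∸ x ≤_) (m+n∸n≡m k x) (∸-monoˡ-≤ x q≤k+x)

  VisibleRun : ℕ → ℕ → ℕ → ℕ → Set
  VisibleRun s b a p = ∀ {x} → a ≤ x → x < p → Visible s b x

  emptyRun : ∀ {s b a} → VisibleRun s b a a
  emptyRun a≤x x<a = ⊥-elim (<⇒≱ x<a a≤x)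

  run-extend : ∀ {s b a p} → VisibleRun s b a p → Visible s b p → VisibleRun s b a (suc p)
  run-extend {p = p} run vp {x} a≤x x<1+p with x <? p
  ... | yes x<p = run a≤x x<p
  ... | no  x≮p with ≤-antisym (≤-pred x<1+p) (≮⇒≥ x≮p)
  ...   | refl = vp

  run-last : ∀ {s b a m} → VisibleRun s b a (a + suc m) → Visible s b (a + m)
  run-last {a = a} {m} run = run (m≤m+n a m) (+-monoʳ-< a ≤-refl)

  SoundScan : ℕ → ℕ → ℕ → ScanResult → Set
  SoundScan s b a r = EveryNode (GoodNode θ) (toNode r) ×
                      (0 < positives (corners (toNode r)) → ∃[ y ] a ≤ y × Visible s b y)

  module _ (noInsertable : ∀ i j → ¬ Insertable θ n S i j) where

    visible-pair-insertable : ∀ {s b x y} → Region s b → Visible s b x → Visible s b y →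
                              x < y → θ < y ∸ x → Insertable θ n S x y
    visible-pair-insertable {s} {x = x} {y} R vx vy x<y loop = record
      { lower   = ≤-trans (Region.lower R) (Visible.start≤ vx)
      ; ordered = x<y
      ; upper   = ≤-pred (≤-trans (Visible.<end vy) (Region.upper R))
      ; loop    = loop
      ; freeˡ   = Visible.free vx
      ; freeʳ   = Visible.free vy
      ; noCrossingInside  = λ m x<k k<y y<l →
          Visible.uncovered vy m (≤-trans (Visible.start≤ vx) (<⇒≤ x<k)) k<y y<l
      ; noCrossingOutside = outside
      }
      where
      outside : ∀ {k l} → (k , l) ∈ S → k < x → x < l → l < y → ⊥
      outside {k} m k<x x<l l<y with s ≤? k
      ... | yes s≤k = Visible.uncovered vx m s≤k k<x x<l
      ... | no  s≰k = Region.noEntry R m (≰⇒> s≰k) (≤-trans (Visible.start≤ vx) (<⇒≤ x<l))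
                        (<-trans l<y (Visible.<end vy))

    visible-near : ∀ {s b x y} → Region s b → Visible s b x → Visible s b y → y ∸ x ≤ θ
    visible-near {x = x} {y} R vx vy with x <? y
    ... | no  x≮y = subst (_≤ θ) (sym (m≤n⇒m∸n≡0 (≮⇒≥ x≮y))) z≤n
    ... | yes x<y = ≮⇒≥ (noInsertable x y ∘ visible-pair-insertable R vx vy x<y)

    run-short : ∀ {s b a} acc → Region s b → VisibleRun s b a (a + acc) → acc ≤ suc θ
    run-short         zero    R run = z≤n
    run-short {a = a} (suc m) R run =
      s≤s (subst (_≤ θ) (m+n∸m≡n a m) (visible-near R (run ≤-refl (m<m+n a (s≤s z≤n))) (run-last run)))

    sound-end : ∀ {s b a p} acc → Region s b → VisibleRun s b a p → a + acc ≡ p → SoundScan s b a (acc , [])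
    sound-end zero    R run eq = (((z≤n ∷ []) , z≤n) , tt) , λ ()
    sound-end (suc m) R run refl =
      (((run-short (suc m) R run ∷ []) , ≤-refl) , tt) , λ _ → _ , m≤m+n _ m , run-last run

    sound-link : ∀ {s b a p q k t} acc {rest} → Region s b → VisibleRun s b a p → a + acc ≡ p → (p , q) ∈ S →
                 EveryNode (GoodNode θ) t → SoundScan s b (suc q) rest →
                 SoundScan s b a (acc , (k , t , proj₁ rest) ∷ proj₂ rest)
    sound-link {a = a} {q = q} zero R run refl pq good-t ((good-rest , good-later) , witness) =
      ((z≤n ∷ proj₁ good-rest , proj₂ good-rest) , good-t , good-later) ,
      λ pos → let (y , q<y , vy) = witness pos
              in y , ≤-trans (m≤m+n a 0) (≤-trans (<⇒≤ (link< pq)) (<⇒≤ q<y)) , vy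
    sound-link {a = a} {p = p} {q} (suc m) {rest} R run refl pq good-t ((good-rest , good-later) , witness) =
      ((run-short (suc m) R run ∷ proj₁ good-rest , s≤s rest-unpositive) , good-t , good-later) ,
      λ _ → a + m , m≤m+n a m , run-last run
      where
      -- a free element left of the link (p , q) and one right of it are more than θ apart
      rest-unpositive : positives (corners (toNode rest)) ≤ 0
      rest-unpositive = ≮⇒≥ λ pos →
        let (y , q<y , vy) = witness pos
            a+m<p = +-monoʳ-< a ≤-refl
        in <⇒≱ (<-≤-trans (minLoop pq) (∸-mono (≤-trans (n≤1+n q) q<y) (<⇒≤ a+m<p)))
               (visible-near R (run-last run) vy)

    scan-sound : ∀ f {s b p a acc} → Region s b → ClosedSpan s p → VisibleRun s b a p → a + acc ≡ p →
                 SoundScan s b a (scan S n f p b acc)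
    scan-sound zero {acc = acc} R C run eq = sound-end acc R run eq
    scan-sound (suc f) {s} {b} {p} {a} {acc} R C run eq with p <? b
    ... | no  _   = sound-end acc R run eq
    ... | yes p<b with opener S p in e
    ...   | nothing =
      scan-sound f R (closedSpan-unopened C unopened)
        (run-extend run (visible-unopened R C p<b unopened)) (trans (+-suc a acc) (cong suc eq))
      where
      unopened = opener≡nothing⇒∉ S p e
    ...   | just q =
      sound-link {k = proj₁ (stem S n p q)} acc {rest = scan S n f (suc q) b 0} R run eq pq
        (proj₁ (scan-sound f (innerRegion innermost) closedSpan-refl emptyRun (+-identityʳ _)))
        (scan-sound f R (closedSpan-link C pq) emptyRun (+-identityʳ _))
      where
      pq = opener≡just⇒∈ S p q e
      open StemOf (stemOf n pq)

    noInsertable⇒good : EveryNode (GoodNode θ) (dual n S)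
    noInsertable⇒good = proj₁ (scan-sound (suc (suc n)) rootRegion closedSpan-refl emptyRun refl)

  -- b ≤ p + f: the fuel of scan lasts until the end b of the region.
  scan-sees-visible : ∀ f {s b p acc y} → s ≤ p → Visible s b y → p ≤ y → b ≤ p + f →
                      let r = scan S n f p b acc in acc + (y ∸ p) < proj₁ r ⊎ 1 ≤ positives (laterCorners r)
  scan-sees-visible zero {p = p} s≤p vy p≤y b≤p+0 =
    ⊥-elim (<⇒≱ (≤-<-trans p≤y (Visible.<end vy)) (≤-trans b≤p+0 (≤-reflexive (+-identityʳ p))))
  scan-sees-visible (suc f) {s} {b} {p} {acc} {y} s≤p vy p≤y fuel with p <? b
  ... | no p≮b = ⊥-elim (p≮b (≤-<-trans p≤y (Visible.<end vy)))
  ... | yes _ with opener S p in e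
  ...   | just q = inj₂ (positive-somewhere
      (scan-sees-visible f {acc = 0} (≤-trans s≤p (<⇒≤ (m<n⇒m<1+n (link< pq)))) vy q<y
        (fuel-step (<⇒≤ (link< pq)) fuel)))
    where
    pq = opener≡just⇒∈ S p q e
    p<y : p < y
    p<y = ≤∧≢⇒< p≤y (λ { refl → proj₁ (Visible.free vy) q pq })
    q<y : q < y
    q<y with <-cmp q y
    ... | tri< q<y _ _  = q<y
    ... | tri≈ _ refl _ = ⊥-elim (proj₂ (Visible.free vy) p pq)
    ... | tri> _ _ y<q  = ⊥-elim (Visible.uncovered vy pq s≤p p<y y<q)
  ...   | nothing with p ≟ y
  ...     | yes refl = inj₁ (subst (_< proj₁ (scan S n f (suc p) b (suc acc))) acc≡
                              (scan-acc≤ S n f (suc p) b (suc acc)))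
    where
    acc≡ : acc ≡ acc + (p ∸ p)
    acc≡ = sym (trans (cong (acc +_) (n∸n≡0 p)) (+-identityʳ acc))
  ...     | no  p≢y = map₁ (subst (_< proj₁ (scan S n f (suc p) b (suc acc))) shift)
                        (scan-sees-visible f (≤-trans s≤p (n≤1+n p)) vy p<y (fuel-step ≤-refl fuel))
    where
    p<y = ≤∧≢⇒< p≤y p≢y
    shift : suc acc + (y ∸ suc p) ≡ acc + (y ∸ p)
    shift = sym (trans (cong (acc +_) (+-∸-assoc 1 p<y)) (+-suc acc (y ∸ suc p)))

  module _ {i j : ℕ} (ins : Insertable θ n S i j) where
    open Insertable ins

    visible-right-end : ∀ {s b} → ClosedSpan s i → j < b → Visible s b j
    visible-right-end {s} C j<b = record
      { start≤    = ≤-trans (ClosedSpan.start≤ C) (<⇒≤ ordered)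
      ; <end      = j<b
      ; free      = freeʳ
      ; uncovered = uncovered
      }
      where
      uncovered : ∀ {k l} → (k , l) ∈ S → s ≤ k → k < j → j < l → ⊥
      uncovered {k} {l} m s≤k k<j j<l with <-cmp k i
      ... | tri< k<i _ _  = <⇒≱ (<-trans (ClosedSpan.closes C m s≤k k<i) ordered) (<⇒≤ j<l)
      ... | tri≈ _ refl _ = proj₁ freeˡ l m
      ... | tri> _ _ i<k  = noCrossingInside m i<k k<j j<l

    crowded⇒¬good : ∀ {c L acc d} → θ ≤ d → suc acc + d < c ⊎ 1 ≤ positives L → suc acc ≤ c →
                    All (λ w → w ≤ suc θ) (c ∷ L) → positives (c ∷ L) ≤ 1 → ⊥
    crowded⇒¬good {acc = acc} {d} θ≤d (inj₁ long) _ (c≤1+θ ∷ _) _ =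
      <⇒≱ (≤-<-trans (s≤s (≤-trans θ≤d (m≤n+m d acc))) long) c≤1+θ
    crowded⇒¬good _ (inj₂ 1≤L) (s≤s _) _ (s≤s L≤0) = <⇒≱ 1≤L L≤0

    insertable⇒¬good-scan : ∀ f {s b p acc} → Region s b → ClosedSpan s p → p ≤ i → j < b → b ≤ p + f →
                            ¬ EveryNode (GoodNode θ) (toNode (scan S n f p b acc))
    insertable⇒¬good-scan zero {p = p} R C p≤i j<b b≤p+0 _ =
      <⇒≱ (<-trans (≤-<-trans p≤i ordered) j<b) (≤-trans b≤p+0 (≤-reflexive (+-identityʳ p)))
    insertable⇒¬good-scan (suc f) {s} {b} {p} {acc} R C p≤i j<b fuel good with p <? b
    ... | no p≮b = p≮b (≤-<-trans p≤i (<-trans ordered j<b))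
    ... | yes p<b with opener S p in e
    ...   | nothing with p ≟ i
    ...     | yes refl = crowded⇒¬good θ≤d sees (scan-acc≤ S n f (suc p) b (suc acc)) all pos
      where
      all = proj₁ (proj₁ good)
      pos = proj₂ (proj₁ good)
      sees = scan-sees-visible f (≤-trans (ClosedSpan.start≤ C) (n≤1+n p)) (visible-right-end C j<b) ordered
               (fuel-step ≤-refl fuel)
      θ≤d : θ ≤ j ∸ suc i
      θ≤d = ≤-pred (subst (θ <_) (+-∸-assoc 1 ordered) loop)
    ...     | no p≢i =
      insertable⇒¬good-scan f R (closedSpan-unopened C (opener≡nothing⇒∉ S p e)) (≤∧≢⇒< p≤i p≢i) j<b
        (fuel-step ≤-refl fuel) good
    insertable⇒¬good-scan (suc f) {s} {b} {p} {acc} R C p≤i j<b fuel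
      ((all , pos) , good-sub , good-later) | yes p<b | just q with <-cmp i q
    ... | tri≈ _ refl _ = proj₂ freeˡ p pq
      where
      pq = opener≡just⇒∈ S p q e
    ... | tri> _ _ q<i =
      insertable⇒¬good-scan f R (closedSpan-link C pq) q<i j<b (fuel-step (<⇒≤ (link< pq)) fuel)
        (((All.tail all) , ≤-trans (positives-tail acc _) pos) , good-later)
      where
      pq = opener≡just⇒∈ S p q e
    ... | tri< i<q _ _ =
      insertable⇒¬good-scan f (innerRegion innermost) closedSpan-refl i′<i j<j′
        (≤-trans j′≤q (≤-trans (<⇒≤ q<b) (fuel-step p≤i′ fuel))) good-sub
      where
      pq = opener≡just⇒∈ S p q e
      open StemOf (stemOf n pq)
      p<i : p < i
      p<i = ≤∧≢⇒< p≤i (λ { refl → proj₁ freeˡ q pq })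
      q<b : q < b
      q<b = Region.noExit R pq (ClosedSpan.start≤ C) p<b
      j<q : j < q
      j<q with <-cmp j q
      ... | tri< j<q _ _  = j<q
      ... | tri≈ _ refl _ = ⊥-elim (proj₂ freeʳ p pq)
      ... | tri> _ _ q<j  = ⊥-elim (noCrossingOutside pq p<i i<q q<j)
      i′<i : suc (proj₁ (proj₂ (stem S n p q))) ≤ i
      i′<i = ≰⇒> λ i≤i′ → pairedLeft (<⇒≤ p<i) i≤i′ freeˡ
      j<j′ : j < proj₂ (proj₂ (stem S n p q))
      j<j′ = ≰⇒> λ j′≤j → pairedRight j′≤j (<⇒≤ j<q) freeʳ

    insertable⇒¬good : ¬ EveryNode (GoodNode θ) (dual n S)
    insertable⇒¬good = insertable⇒¬good-scan (suc (suc n)) rootRegion closedSpan-refl lower (s≤s upper)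
                         (≤-trans (n≤1+n _) (n≤1+n _))

  good⇔noInsertable : EveryNode (GoodNode θ) (dual n S) ⇔ (∀ i j → ¬ Insertable θ n S i j)
  good⇔noInsertable = mk⇔ (λ good i j ins → insertable⇒¬good ins good) noInsertable⇒good

lemma1 : (θ n : ℕ) (S : List Link) → SecStr θ 0 n S → ¬ (S ≡ []) →
    Saturated θ 0 n S ⇔ (CondI θ (dual n S) × CondII (dual n S))
lemma1 θ n S ss _ = begin
  Saturated θ 0 n S                              ≈⟨ saturated⇔noInsertable ss ⟩
  (∀ i j → ¬ Insertable θ n S i j)               ≈⟨ good⇔noInsertable ss ⟨
  EveryNode (GoodNode θ) (dual n S)              ≈⟨ EveryNode-× (dual n S) ⟩
  (CondI θ (dual n S) × CondII (dual n S))       ∎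
  where open SetoidReasoning (⇔-setoid 0ℓ)
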